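{- Let $G=(V,E)$ be a simple connected triangle-free cubic graph. If $G$ has a bridge, then for every valid labeling $\lambda$ of $\mathfrak{L}_2(G)$ there is a reduced clique $\mathbb{X}$ which is a Type A self-intersection of some cycle of $\Gamma_\lambda$.
   Context: Line graph $\mathcal{L}(H)$: vertex set $E(H)$, two edges adjacent iff they share exactly one endpoint. For each triangle $T$ of $\mathcal{L}(G)$ its three edges span a triangle in $\mathcal{L}(\mathcal{L}(G))$; $\mathfrak{L}_2(G)$ is $\mathcal{L}(\mathcal{L}(G))$ with all edges of all these triangles deleted. Reduced cliques: for each $x\in E$ the four edges of $\mathcal{L}(G)$ incident to $x$ form a $K_4$ in $\mathcal{L}(\mathcal{L}(G))$; the reduced clique $\mathbb{X}_x$ is this $K_4$ minus the deleted edges (a $4$-cycle). A labeling $\lambda:E(\mathfrak{L}_2(G))\to\{0,1\}$ (1 = open, 0 = closed) is valid if for every reduced clique $\mathbb{X}$ and every vertex $v$ of $\mathbb{X}$ there are vertices $w,u\neq v$ of $\mathbb{X}$ with $\langle v,w\rangle,\langle v,u\rangle\in E(\mathbb{X})$ and $\lambda_{\langle v,w\rangle}=1-\lambda_{\langle v,u\rangle}$; thus the open edges of each reduced clique form one of its two perfect matchings. The open edges form a disjoint union of cycles, whose set is $\Gamma_\lambda$. The label inversion $\mathcal{F}_{\mathbb{X}}$ replaces $\lambda_e$ by $1-\lambda_e$ for all edges $e$ of $\mathbb{X}$ and leaves other labels unchanged. A reduced clique $\mathbb{X}$ is a self-intersection of $\gamma\in\Gamma_\lambda$ if both open edges of $\mathbb{X}$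 lie on $\gamma$; it is of Type A if after applying $\mathcal{F}_{\mathbb{X}}$ the edges of $\gamma$ outside $\mathbb{X}$ together with the new open edges of $\mathbb{X}$ still form a single cycle, and of Type B if they form two cycles. -}

module Defs where

open import Data.Nat as ℕ using (ℕ)
open import Data.Bool using (Bool; true; false; T; not; _∧_; _∨_)
open import Data.Fin using (Fin; toℕ)
open import Data.Fin.Properties using () renaming (_≟_ to _≟ᶠ_)
open import Data.List using (List; length; filterᵇ; allFin)
open import Data.Product using (Σ; ∃; ∃-syntax; _×_; _,_)
open import Data.Sum using (_⊎_)
open import Relation.Binary.PropositionalEquality using (_≡_; _≢_)
open import Relation.Binary.Construct.Closure.ReflexiveTransitive using (Star)
open import Relation.Nullary using (¬_; does)

record SimpleGraph : Set where
  field
    n      : ℕ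
    adj    : Fin n → Fin n → Bool
    sym    : ∀ u v → adj u v ≡ adj v u
    loopless : ∀ v → adj v v ≡ false

module _ (G : SimpleGraph) where
  open SimpleGraph G

  Adj : Fin n → Fin n → Set
  Adj u v = T (adj u v)

  degree : Fin n → ℕ
  degree v = length (filterᵇ (adj v) (allFin n))

  Cubic : Set
  Cubic = ∀ v → degree v ≡ 3

  Connected : Set
  Connected = ∀ u v → Star Adj u v

  TriangleFree : Set
  TriangleFree = ∀ a b c → Adj a b → Adj b c → Adj a c → ⊥'
    where open import Data.Empty renaming (⊥ to ⊥')

  IsBridge : Fin n → Fin n → Set
  IsBridge a b =
    Adj a b ×
    ¬ Star (λ u v → Adj u v × ¬ ((u ≡ a × v ≡ b) ⊎ (u ≡ b × v ≡ a))) a b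

  HasBridge : Set
  HasBridge = ∃[ a ] ∃[ b ] IsBridge a b

  -- E(G) = V(L(G)): an edge {lo,hi} stored canonically with lo < hi.
  -- (proof fields are T-valued, hence definitionally proof-irrelevant,
  --  so ≡ on EdgeG is equality of the unordered pair)

  record EdgeG : Set where
    constructor edge
    field
      lo hi : Fin n
      ord   : T (toℕ lo ℕ.<ᵇ toℕ hi)
      isAdj : T (adj lo hi)
  open EdgeG public

  endᵇ : Fin n → EdgeG → Bool
  endᵇ v e = does (v ≟ᶠ lo e) ∨ does (v ≟ᶠ hi e)

  common : EdgeG → EdgeG → ℕ
  common e f = length (filterᵇ (λ v → endᵇ v e ∧ endᵇ v f) (allFin n))

  Adj₁ : EdgeG → EdgeG → Set
  Adj₁ e f = common e f ≡ 1

  _<ᴱ_ : EdgeG → EdgeG → Bool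
  e <ᴱ f = (toℕ (lo e) ℕ.<ᵇ toℕ (lo f)) ∨
           ((toℕ (lo e) ℕ.≡ᵇ toℕ (lo f)) ∧ (toℕ (hi e) ℕ.<ᵇ toℕ (hi f)))

  -- E(L(G)) = V(L(L(G))) = V(𝔏₂(G)): an unordered pair {fst,snd} of
  -- edges of G sharing exactly one endpoint, stored with fst <ᴱ snd.

  record EdgeL : Set where
    constructor edgeL
    field
      fst snd : EdgeG
      ordL    : T (fst <ᴱ snd)
      share   : T (common fst snd ℕ.≡ᵇ 1)
  open EdgeL public

  _∈ₗ_ : EdgeG → EdgeL → Set
  x ∈ₗ p = x ≡ fst p ⊎ x ≡ snd p

  Adj₂ : EdgeL → EdgeL → Set
  Adj₂ p q = ∃[ x ] (x ∈ₗ p × x ∈ₗ q × (∀ y → y ∈ₗ p → y ∈ₗ q → y ≡ x))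

  TriangleL : EdgeG → EdgeG → EdgeG → Set
  TriangleL a b c = Adj₁ a b × Adj₁ b c × Adj₁ a c

  EdgeOfTri : EdgeL → EdgeG → EdgeG → EdgeG → Set
  EdgeOfTri p a b c = ∀ y → y ∈ₗ p → y ≡ a ⊎ y ≡ b ⊎ y ≡ c

  Deleted : EdgeL → EdgeL → Set
  Deleted p q = ∃[ a ] ∃[ b ] ∃[ c ]
    (TriangleL a b c × EdgeOfTri p a b c × EdgeOfTri q a b c)

  Adj𝔏 : EdgeL → EdgeL → Set
  Adj𝔏 p q = Adj₂ p q × ¬ Deleted p q

  -- edges of the reduced clique 𝕏ₓ (x ∈ E(G)): edges of the K₄ on the
  -- L(G)-edges incident to x, minus the deleted edges
  XEdge : EdgeG → EdgeL → EdgeL → Set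
  XEdge x p q = x ∈ₗ p × x ∈ₗ q × Adj𝔏 p q

  -- Labelings: a symmetric function on pairs of vertices of 𝔏₂(G);
  -- only its values on edges of 𝔏₂(G) matter (true = open = 1).

  Labeling : Set
  Labeling = Σ (EdgeL → EdgeL → Bool) (λ l → ∀ p q → l p q ≡ l q p)

  module _ (L : Labeling) where
    private
      lab : EdgeL → EdgeL → Bool
      lab = Data.Product.proj₁ L
        where import Data.Product

    Valid : Set
    Valid = ∀ x v → x ∈ₗ v →
      ∃[ w ] ∃[ u ] (w ≢ v × u ≢ v × XEdge x v w × XEdge x v u ×
                     lab v w ≡ not (lab v u))

    Open : EdgeL → EdgeL → Set
    Open p q = Adj𝔏 p q × lab p q ≡ true

    -- γ ∈ Γ_λ, given by its vertex set C: a connected component of the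
    -- graph of open edges
    InΓ : (EdgeL → Set) → Set
    InΓ C = (∃[ p ] C p) ×
            (∀ p q → C p → Open p q → C q) ×
            (∀ p q → C p → C q → Star Open p q)

    EdgeOfγ : (EdgeL → Set) → EdgeL → EdgeL → Set
    EdgeOfγ C p q = Open p q × C p × C q

    SelfIntersection : EdgeG → (EdgeL → Set) → Set
    SelfIntersection x C =
      ∀ p q → XEdge x p q → lab p q ≡ true → EdgeOfγ C p q

    -- the edges of γ outside 𝕏ₓ together with the open edges of 𝕏ₓ
    -- after the label inversion 𝓕_𝕏ₓ (i.e. the edges of 𝕏ₓ whose label
    -- under λ was 0)
    AfterFlip : EdgeG → (EdgeL → Set) → EdgeL → EdgeL → Set
    AfterFlip x C p q =
      (EdgeOfγ C p q × ¬ XEdge x p q) ⊎ (XEdge x p q × lab p q ≡ false)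

    SingleCycle : (EdgeL → EdgeL → Set) → Set
    SingleCycle S =
      (∃[ p ] ∃[ q ] S p q) ×
      (∀ p q → S p q →
         ∃[ a ] ∃[ b ] (a ≢ b × S p a × S p b ×
                        (∀ c → S p c → c ≡ a ⊎ c ≡ b))) ×
      (∀ p p' q q' → S p p' → S q q' → Star S p q)

    TypeA : EdgeG → (EdgeL → Set) → Set
    TypeA x C = SelfIntersection x C × SingleCycle (AfterFlip x C)

-- Let e = ab be the bridge.  The vertices of the reduced clique 𝕏ₑ are the pairs {e, f} of
-- edges meeting e; call the common vertex of such a pair its centre (a or b).  Pairs with equal
-- centre are not adjacent in 𝔏₂(G), and by cubicity each centre carries exactly two pairs, so
-- 𝕏ₑ is a 4-cycle alternating between centre a and centre b.  A valid labeling gives every vertex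
-- of 𝔏₂(G) exactly two open neighbours, so the open edges form disjoint cycles.  Follow the open
-- cycle γ through a pair p₀ of centre a, leaving 𝕏ₑ.  Along an open edge outside 𝕏ₑ the centres
-- are joined by an edge of G other than e, so until γ uses an edge of 𝕏ₑ again its centres stay
-- on a's side of the bridge; it therefore returns to 𝕏ₑ at the other pair of centre a.  Hence γ
-- carries both open edges of 𝕏ₑ, and after inverting the labels of 𝕏ₑ its two arcs are joined by
-- the two formerly closed edges into a single cycle.
module Submission where

open import Defs
open import Data.Bool using (Bool; true; false; T; T?; not; _∧_; if_then_else_)
open import Data.Bool.Properties using (T-irrelevant; T-∧; T-∨; not-¬)
open import Data.Empty using (⊥-elim)
open import Data.Fin as Fin using (Fin; toℕ)
import Data.Fin.Properties as Finₚ
open import Data.List using (List; []; _∷_; length; lookup; filterᵇ; allFin)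
open import Data.List.Membership.Propositional using (_∈_)
open import Data.List.Membership.Propositional.Properties using (∈-filter⁺; ∈-filter⁻; ∈-allFin; ∈-lookup)
import Data.List.Membership.Setoid.Properties as Membershipₛ
open import Data.List.Relation.Unary.All as All using (All; []; _∷_)
open import Data.List.Relation.Unary.AllPairs using ([]; _∷_)
open import Data.List.Relation.Unary.Any using (here; there; index)
open import Data.List.Relation.Unary.Unique.Propositional using (Unique)
import Data.List.Relation.Unary.Unique.Propositional.Properties as Uniqueₚ
open import Data.Nat using (ℕ; zero; suc; _+_; _*_; _≤_; _<_; z≤n; s≤s)
open import Data.Nat.GeneralisedArithmetic using (fold)
import Data.Nat.Properties as ℕₚ
open import Data.Product using (∃; ∃-syntax; _×_; _,_; proj₁; proj₂; swap)
import Data.Product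
open import Data.Product.Relation.Binary.Lex.Strict using (×-Lex; ×-isStrictTotalOrder)
open import Data.Sum using (_⊎_; inj₁; inj₂; [_,_]′)
import Data.Sum
open import Data.Unit using (tt)
open import Function using (_∘_; _$_; flip; Equivalence)
open import Relation.Binary using (IsStrictTotalOrder; DecidableEquality; tri<; tri≈; tri>)
open import Relation.Binary.PropositionalEquality
open import Relation.Nullary using (¬_; ¬?; Dec; yes; no; does; contradiction)
open import Relation.Nullary.Decidable using (_×-dec_)
open import Relation.Binary.Construct.Closure.ReflexiveTransitive using (Star; ε; _◅_; _◅◅_; reverse)

module Counting {m : ℕ} (P : Fin m → Bool) where

  satisfying : List (Fin m)
  satisfying = filterᵇ P (allFin m)

  ∈-satisfying : ∀ {v} → T (P v) → v ∈ satisfying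
  ∈-satisfying = ∈-filter⁺ (T? ∘ P) (∈-allFin _)

  satisfying-sound : ∀ {v} → v ∈ satisfying → T (P v)
  satisfying-sound = proj₂ ∘ ∈-filter⁻ (T? ∘ P) {xs = allFin m}

  satisfying-unique : Unique satisfying
  satisfying-unique = Uniqueₚ.filter⁺ (T? ∘ P) (Uniqueₚ.allFin⁺ m)

  count≤1 : ∀ c → (∀ v → T (P v) → v ≡ c) → length satisfying ≤ 1
  count≤1 c only-c = go satisfying-unique (λ v∈ → only-c _ (satisfying-sound v∈))
    where
      go : ∀ {xs} → Unique xs → (∀ {v} → v ∈ xs → v ≡ c) → length xs ≤ 1
      go {[]}        _                     _   = z≤n
      go {_ ∷ []}    _                     _   = s≤s z≤n
      go {_ ∷ _ ∷ _} ((x≢y ∷ _) ∷ _) all-c =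
        contradiction (trans (all-c (here refl)) (sym (all-c (there (here refl))))) x≢y

  lookup-injective : ∀ {xs : List (Fin m)} → Unique xs →
                     ∀ i j → lookup xs i ≡ lookup xs j → i ≡ j
  lookup-injective {_ ∷ _} _         Fin.zero    Fin.zero    _  = refl
  lookup-injective {_ ∷ _} (x∉ ∷ _)  Fin.zero    (Fin.suc j) eq = contradiction eq (All.lookup x∉ (∈-lookup j))
  lookup-injective {_ ∷ _} (x∉ ∷ _)  (Fin.suc i) Fin.zero    eq = contradiction (sym eq) (All.lookup x∉ (∈-lookup i))
  lookup-injective {_ ∷ _} (_ ∷ u)   (Fin.suc i) (Fin.suc j) eq = cong Fin.suc (lookup-injective u i j eq)

  unique-≤-count : ∀ {xs} → Unique xs → All (T ∘ P) xs → length xs ≤ length satisfying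
  unique-≤-count {xs} u sat = ℕₚ.≮⇒≥ λ count<len →
    let (i , j , i<j , same-index) = Finₚ.pigeonhole count<len position
    in  Finₚ.<⇒≢ i<j (lookup-injective u i j
          (Membershipₛ.index-injective (setoid (Fin m)) (member i) (member j) same-index))
    where
      member : ∀ i → lookup xs i ∈ satisfying
      member i = ∈-satisfying (All.lookup sat (∈-lookup i))
      position : Fin (length xs) → Fin (length satisfying)
      position = index ∘ member

  count≡1 : ∀ c → T (P c) → (∀ v → T (P v) → v ≡ c) → length satisfying ≡ 1
  count≡1 c pc only-c =
    ℕₚ.≤-antisym (count≤1 c only-c) (unique-≤-count ([] ∷ []) (pc ∷ []))

  count≡1⇒witness : length satisfying ≡ 1 → ∃ (T ∘ P)
  count≡1⇒witness = witness satisfying-sound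
    where
      witness : ∀ {xs} → (∀ {v} → v ∈ xs → T (P v)) → length xs ≡ 1 → ∃ (T ∘ P)
      witness {v ∷ _} sound _ = v , sound (here refl)

module Orbits {A : Set} {N : ℕ} (encode : A → Fin N) (encode-injective : ∀ {x y} → encode x ≡ encode y → x ≡ y)
              (f g : A → A) (x : A) where

  orbit : ℕ → A
  orbit = fold x f

  module _ (g-inverts-f : ∀ k → g (f (orbit k)) ≡ orbit k) where

    orbit-cancel : ∀ i m → orbit i ≡ orbit (i + m) → x ≡ orbit m
    orbit-cancel zero    m same = same
    orbit-cancel (suc i) m same = orbit-cancel i m (begin
      orbit i                ≡⟨ sym (g-inverts-f i) ⟩
      g (orbit (suc i))      ≡⟨ cong g same ⟩
      g (orbit (suc i + m))  ≡⟨ g-inverts-f (i + m) ⟩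
      orbit (i + m)          ∎)
      where open ≡-Reasoning

    orbit-returns : ∃[ d ] orbit (suc d) ≡ x
    orbit-returns =
      let (i , j , i<j , same-code) = Finₚ.pigeonhole (ℕₚ.n<1+n N) (encode ∘ orbit ∘ toℕ)
          (d , i+1+d≡j) = ℕₚ.m≤n⇒∃[o]m+o≡n i<j
          j≡i+[1+d] = trans (sym i+1+d≡j) (sym (ℕₚ.+-suc (toℕ i) d))
      in  d , sym (orbit-cancel (toℕ i) (suc d) (trans (encode-injective same-code) (cong orbit j≡i+[1+d])))

module TwoRegular {A : Set} (_≟_ : DecidableEquality A) (R : A → A → Set)
                  (R-sym : ∀ {p q} → R p q → R q p) (R-irrefl : ∀ p → ¬ R p p)
                  (nbr₁ nbr₂ : A → A) (R-nbr₁ : ∀ q → R q (nbr₁ q)) (R-nbr₂ : ∀ q → R q (nbr₂ q))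
                  (nbr₁≢nbr₂ : ∀ q → nbr₁ q ≢ nbr₂ q)
                  (R⇒nbr : ∀ {q p} → R q p → p ≡ nbr₁ q ⊎ p ≡ nbr₂ q) where

  opaque
    next : A → A → A
    next p q = if does (p ≟ nbr₁ q) then nbr₂ q else nbr₁ q

    R-next : ∀ p q → R q (next p q)
    R-next p q with p ≟ nbr₁ q
    ... | yes _ = R-nbr₂ q
    ... | no _  = R-nbr₁ q

    next-≢ : ∀ p q → next p q ≢ p
    next-≢ p q with p ≟ nbr₁ q
    ... | yes p≡nbr₁ = λ nbr₂≡p → nbr₁≢nbr₂ q (trans (sym p≡nbr₁) (sym nbr₂≡p))
    ... | no p≢nbr₁  = p≢nbr₁ ∘ sym

    next-next : ∀ {p q} → R q p → next (next p q) q ≡ p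
    next-next {p} {q} qp with p ≟ nbr₁ q
    next-next {p} {q} qp | yes p≡nbr₁ with nbr₂ q ≟ nbr₁ q
    ... | yes nbr₂≡nbr₁ = contradiction (sym nbr₂≡nbr₁) (nbr₁≢nbr₂ q)
    ... | no _          = sym p≡nbr₁
    next-next {p} {q} qp | no p≢nbr₁ with nbr₁ q ≟ nbr₁ q
    ... | yes _ = [ flip contradiction p≢nbr₁ , sym ]′ (R⇒nbr qp)
    ... | no nbr₁≢nbr₁ = contradiction refl nbr₁≢nbr₁

  module Walk {N : ℕ} (encode : A → Fin N) (encode-injective : ∀ {x y} → encode x ≡ encode y → x ≡ y)
              (x₀ x₁ : A) (R₀₁ : R x₀ x₁) where

    step back : A × A → A × A
    step (p , q) = q , next p q
    back (q , r) = next r q , q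

    state : ℕ → A × A
    state = fold (x₀ , x₁) step

    walk : ℕ → A
    walk = proj₁ ∘ state

    walk-R : ∀ k → R (walk k) (walk (suc k))
    walk-R zero    = R₀₁
    walk-R (suc k) = R-next (walk k) (walk (suc k))

    back-step : ∀ k → back (state (suc k)) ≡ state k
    back-step k = cong (_, walk (suc k)) (next-next (R-sym (walk-R k)))

    no-reversal : ∀ k i → state (k + i) ≢ swap (state i)
    no-reversal zero          i same = R-irrefl (walk i) (subst (R (walk i)) (sym (cong proj₁ same)) (walk-R i))
    no-reversal (suc zero)    i same = next-≢ (walk i) (walk (suc i)) (cong proj₂ same)
    no-reversal (suc (suc k)) i same = no-reversal k (suc i) (begin
      state (k + suc i)      ≡⟨ cong state (ℕₚ.+-suc k i) ⟩
      state (suc k + i)      ≡⟨ sym (back-step (suc k + i)) ⟩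
      back (state (2 + k + i)) ≡⟨ cong back same ⟩
      swap (state (suc i))   ∎)
      where open ≡-Reasoning

    encodeState : A × A → Fin (N * N)
    encodeState (p , q) = Fin.combine (encode p) (encode q)

    encodeState-injective : ∀ {s s′} → encodeState s ≡ encodeState s′ → s ≡ s′
    encodeState-injective {p , q} {p′ , q′} same with Finₚ.combine-injective (encode p) (encode q) _ _ same
    ... | same₁ , same₂ = cong₂ _,_ (encode-injective same₁) (encode-injective same₂)

    walk-returns : ∃[ d ] state (suc d) ≡ state 0
    walk-returns = Orbits.orbit-returns encodeState encodeState-injective step back (x₀ , x₁) back-step

module UnorderedPair {A : Set} (_≟_ : DecidableEquality A) {a b : A} (a≢b : a ≢ b) where

  Member : A → Set
  Member v = v ≡ a ⊎ v ≡ b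

  other : A → A
  other v = if does (v ≟ a) then b else a

  other-member : ∀ v → Member (other v)
  other-member v with v ≟ a
  ... | yes _ = inj₂ refl
  ... | no _  = inj₁ refl

  other-≢ : ∀ {v} → Member v → other v ≢ v
  other-≢ {v} _ with v ≟ a
  ... | yes v≡a = λ b≡v → a≢b (trans (sym v≡a) (sym b≡v))
  ... | no v≢a  = v≢a ∘ sym

  member-cases : ∀ {u v} → Member v → Member u → u ≡ v ⊎ u ≡ other v
  member-cases {u} {v} v∈ u∈ with v ≟ a
  member-cases (inj₁ v≡a) _          | no v≢a = contradiction v≡a v≢a
  member-cases (inj₂ v≡b) (inj₁ u≡a) | no _   = inj₂ u≡a
  member-cases (inj₂ v≡b) (inj₂ u≡b) | no _   = inj₁ (trans u≡b (sym v≡b))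
  member-cases _          (inj₁ u≡a) | yes v≡a = inj₁ (trans u≡a (sym v≡a))
  member-cases _          (inj₂ u≡b) | yes _   = inj₂ u≡b

  oriented : ∀ {v w} → v ≢ w → Member v → Member w → (a ≡ v × b ≡ w) ⊎ (a ≡ w × b ≡ v)
  oriented v≢w (inj₁ v≡a) (inj₁ w≡a) = contradiction (trans v≡a (sym w≡a)) v≢w
  oriented v≢w (inj₁ v≡a) (inj₂ w≡b) = inj₁ (sym v≡a , sym w≡b)
  oriented v≢w (inj₂ v≡b) (inj₁ w≡a) = inj₂ (sym w≡a , sym v≡b)
  oriented v≢w (inj₂ v≡b) (inj₂ w≡b) = contradiction (trans v≡b (sym w≡b)) v≢w

module Edges (G : SimpleGraph) where
  open SimpleGraph G using (n; loopless) renaming (sym to adj-sym)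

  Edge : Set
  Edge = EdgeG G

  lo<hi : ∀ (e : Edge) → toℕ (lo e) < toℕ (hi e)
  lo<hi e = ℕₚ.<ᵇ⇒< _ _ (ord e)

  lo≢hi : ∀ (e : Edge) → lo e ≢ hi e
  lo≢hi e = ℕₚ.<⇒≢ (lo<hi e) ∘ cong toℕ

  module Ends (e : Edge) = UnorderedPair Finₚ._≟_ (lo≢hi e)
  open Ends public using ()
    renaming (other to opp; other-member to opp-∈; other-≢ to opp-≢; member-cases to ∈ᵉ-cases)

  infix 4 _∈ᵉ_
  _∈ᵉ_ : Fin n → Edge → Set
  v ∈ᵉ e = Ends.Member e v

  endᵇ-sound : ∀ {v} {e : Edge} → T (endᵇ G v e) → v ∈ᵉ e
  endᵇ-sound {v} {e} h with v Finₚ.≟ lo e | v Finₚ.≟ hi e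
  ... | yes v≡lo | _        = inj₁ v≡lo
  ... | no _     | yes v≡hi = inj₂ v≡hi

  endᵇ-complete : ∀ {v} {e : Edge} → v ∈ᵉ e → T (endᵇ G v e)
  endᵇ-complete {v} {e} v∈e with v Finₚ.≟ lo e | v Finₚ.≟ hi e
  ... | yes _  | _      = tt
  ... | no _   | yes _  = tt
  ... | no v≢lo | no v≢hi = [ v≢lo , v≢hi ]′ v∈e

  Edge-≡ : ∀ {e f : Edge} → lo e ≡ lo f → hi e ≡ hi f → e ≡ f
  Edge-≡ {edge l h _ _} {edge _ _ _ _} refl refl =
    cong₂ (edge l h) (T-irrelevant _ _) (T-irrelevant _ _)

  _≟ᵉ_ : DecidableEquality Edge
  e ≟ᵉ f with lo e Finₚ.≟ lo f | hi e Finₚ.≟ hi f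
  ... | yes l≡ | yes h≡ = yes (Edge-≡ l≡ h≡)
  ... | no l≢  | _      = no (l≢ ∘ cong lo)
  ... | yes _  | no h≢  = no (h≢ ∘ cong hi)

  adj⇒≢ : ∀ {u v} → Adj G u v → u ≢ v
  adj⇒≢ {u} uv refl = subst T (loopless u) uv

  Edge-≡-by-ends : ∀ {v w} (e f : Edge) → v ≢ w → v ∈ᵉ e → w ∈ᵉ e → v ∈ᵉ f → w ∈ᵉ f → e ≡ f
  Edge-≡-by-ends e f v≢w ve we vf wf
    with Ends.oriented e v≢w ve we | Ends.oriented f v≢w vf wf
  ... | inj₁ (l , h) | inj₁ (l′ , h′) = Edge-≡ (trans l (sym l′)) (trans h (sym h′))
  ... | inj₂ (l , h) | inj₂ (l′ , h′) = Edge-≡ (trans l (sym l′)) (trans h (sym h′))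
  ... | inj₁ (l , h) | inj₂ (l′ , h′) = ⊥-elim $
    ℕₚ.<-asym (subst₂ (λ x y → toℕ x < toℕ y) l h (lo<hi e))
              (subst₂ (λ x y → toℕ x < toℕ y) l′ h′ (lo<hi f))
  ... | inj₂ (l , h) | inj₁ (l′ , h′) = ⊥-elim $
    ℕₚ.<-asym (subst₂ (λ x y → toℕ x < toℕ y) l′ h′ (lo<hi f))
              (subst₂ (λ x y → toℕ x < toℕ y) l h (lo<hi e))

  ends-adjacent : ∀ {v w} (e : Edge) → v ≢ w → v ∈ᵉ e → w ∈ᵉ e → Adj G v w
  ends-adjacent {v} {w} e v≢w ve we with Ends.oriented e v≢w ve we
  ... | inj₁ (refl , refl) = isAdj e
  ... | inj₂ (refl , refl) = subst T (adj-sym w v) (isAdj e)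

  edgeBetween : ∀ {u v} → Adj G u v → ∃[ e ] (u ∈ᵉ e × v ∈ᵉ e)
  edgeBetween {u} {v} uv with ℕₚ.<-cmp (toℕ u) (toℕ v)
  ... | tri< u<v _ _ = edge u v (ℕₚ.<⇒<ᵇ u<v) uv , inj₁ refl , inj₂ refl
  ... | tri≈ _ u≡v _ = contradiction (Finₚ.toℕ-injective u≡v) (adj⇒≢ uv)
  ... | tri> _ _ v<u = edge v u (ℕₚ.<⇒<ᵇ v<u) (subst T (adj-sym u v) uv) , inj₂ refl , inj₁ refl

  opp-injective : ∀ {w} (e f : Edge) → w ∈ᵉ e → w ∈ᵉ f → opp e w ≡ opp f w → e ≡ f
  opp-injective {w} e f we wf same =
    Edge-≡-by-ends e f (opp-≢ e we ∘ sym) we (opp-∈ e w) wf (subst (_∈ᵉ f) (sym same) (opp-∈ f w))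

  opp-adjacent : ∀ {w} (e : Edge) → w ∈ᵉ e → Adj G w (opp e w)
  opp-adjacent {w} e we = ends-adjacent e (opp-≢ e we ∘ sym) we (opp-∈ e w)

  key : Edge → ℕ × ℕ
  key e = toℕ (lo e) , toℕ (hi e)

  _<ˡᵉˣ_ : ℕ × ℕ → ℕ × ℕ → Set
  _<ˡᵉˣ_ = ×-Lex _≡_ _<_ _<_

  open IsStrictTotalOrder (×-isStrictTotalOrder ℕₚ.<-isStrictTotalOrder ℕₚ.<-isStrictTotalOrder)
    using () renaming (irrefl to lex-irrefl; asym to lex-asym; compare to lex-compare)

  <ᴱ⇒<ˡᵉˣ : ∀ {e f : Edge} → T (_<ᴱ_ G e f) → key e <ˡᵉˣ key f
  <ᴱ⇒<ˡᵉˣ h with Equivalence.to T-∨ h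
  ... | inj₁ lo< = inj₁ (ℕₚ.<ᵇ⇒< _ _ lo<)
  ... | inj₂ lo≡∧hi< with Equivalence.to T-∧ lo≡∧hi<
  ...   | lo≡ , hi< = inj₂ (ℕₚ.≡ᵇ⇒≡ _ _ lo≡ , ℕₚ.<ᵇ⇒< _ _ hi<)

  <ˡᵉˣ⇒<ᴱ : ∀ {e f : Edge} → key e <ˡᵉˣ key f → T (_<ᴱ_ G e f)
  <ˡᵉˣ⇒<ᴱ (inj₁ lo<) = Equivalence.from T-∨ (inj₁ (ℕₚ.<⇒<ᵇ lo<))
  <ˡᵉˣ⇒<ᴱ (inj₂ (lo≡ , hi<)) =
    Equivalence.from T-∨ (inj₂ (Equivalence.from T-∧ (ℕₚ.≡⇒≡ᵇ _ _ lo≡ , ℕₚ.<⇒<ᵇ hi<)))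

  <ᴱ-irrefl : ∀ (e : Edge) → ¬ T (_<ᴱ_ G e e)
  <ᴱ-irrefl e = lex-irrefl (refl , refl) ∘ <ᴱ⇒<ˡᵉˣ {e} {e}

  <ᴱ-asym : ∀ (e f : Edge) → T (_<ᴱ_ G e f) → ¬ T (_<ᴱ_ G f e)
  <ᴱ-asym e f e<f f<e = lex-asym (<ᴱ⇒<ˡᵉˣ {e} {f} e<f) (<ᴱ⇒<ˡᵉˣ {f} {e} f<e)

  <ᴱ-connex : ∀ (e f : Edge) → e ≢ f → T (_<ᴱ_ G e f) ⊎ T (_<ᴱ_ G f e)
  <ᴱ-connex e f e≢f with lex-compare (key e) (key f)
  ... | tri< e<f _ _ = inj₁ (<ˡᵉˣ⇒<ᴱ {e} {f} e<f)
  ... | tri≈ _ (lo≡ , hi≡) _ =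
    contradiction (Edge-≡ {e} {f} (Finₚ.toℕ-injective lo≡) (Finₚ.toℕ-injective hi≡)) e≢f
  ... | tri> _ _ f<e = inj₂ (<ˡᵉˣ⇒<ᴱ {f} {e} f<e)

  module _ (e f : Edge) where
    open Counting (λ v → endᵇ G v e ∧ endᵇ G v f)

    Adj₁⇒shared-end : Adj₁ G e f → ∃[ c ] (c ∈ᵉ e × c ∈ᵉ f)
    Adj₁⇒shared-end one with count≡1⇒witness one
    ... | c , c∈ with Equivalence.to T-∧ c∈
    ...   | c∈e , c∈f = c , endᵇ-sound {e = e} c∈e , endᵇ-sound {e = f} c∈f

    shared-end⇒Adj₁ : ∀ {c} → e ≢ f → c ∈ᵉ e → c ∈ᵉ f → Adj₁ G e f
    shared-end⇒Adj₁ {c} e≢f ce cf =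
      count≡1 c (Equivalence.from T-∧ (endᵇ-complete {e = e} ce , endᵇ-complete {e = f} cf)) only-c
      where
        only-c : ∀ v → T (endᵇ G v e ∧ endᵇ G v f) → v ≡ c
        only-c v v∈ with v Finₚ.≟ c | Equivalence.to T-∧ v∈
        ... | yes v≡c | _ = v≡c
        ... | no v≢c | ve , vf =
          contradiction (Edge-≡-by-ends e f v≢c (endᵇ-sound {e = e} ve) ce (endᵇ-sound {e = f} vf) cf) e≢f

module Pairs (G : SimpleGraph) where
  open SimpleGraph G using (n)
  open Edges G

  Pair : Set
  Pair = EdgeL G

  fst≢snd : ∀ (p : Pair) → fst p ≢ snd p
  fst≢snd p fst≡snd = <ᴱ-irrefl (snd p) (subst (λ x → T (_<ᴱ_ G x (snd p))) fst≡snd (ordL p))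

  Pair-≡ : ∀ {p q : Pair} → fst p ≡ fst q → snd p ≡ snd q → p ≡ q
  Pair-≡ {edgeL f s _ _} {edgeL _ _ _ _} refl refl =
    cong₂ (edgeL f s) (T-irrelevant _ _) (T-irrelevant _ _)

  _≟ᵖ_ : DecidableEquality Pair
  p ≟ᵖ q with fst p ≟ᵉ fst q | snd p ≟ᵉ snd q
  ... | yes f≡ | yes s≡ = yes (Pair-≡ f≡ s≡)
  ... | no f≢  | _      = no (f≢ ∘ cong fst)
  ... | yes _  | no s≢  = no (s≢ ∘ cong snd)

  module Members (p : Pair) = UnorderedPair _≟ᵉ_ (fst≢snd p)
  open Members public using ()
    renaming (other to partner; other-member to partner-∈; other-≢ to partner-≢; member-cases to ∈ᵖ-cases)

  infix 4 _∈ᵖ_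
  _∈ᵖ_ : Edge → Pair → Set
  x ∈ᵖ p = _∈ₗ_ G x p

  _∈ᵖ?_ : ∀ x p → Dec (x ∈ᵖ p)
  x ∈ᵖ? p with x ≟ᵉ fst p | x ≟ᵉ snd p
  ... | yes x≡ | _      = yes (inj₁ x≡)
  ... | no _   | yes x≡ = yes (inj₂ x≡)
  ... | no x≢  | no x≢′ = no [ x≢ , x≢′ ]′

  Pair-≡-by-members : ∀ {x y} (p q : Pair) → x ≢ y → x ∈ᵖ p → y ∈ᵖ p → x ∈ᵖ q → y ∈ᵖ q → p ≡ q
  Pair-≡-by-members p q x≢y xp yp xq yq
    with Members.oriented p x≢y xp yp | Members.oriented q x≢y xq yq
  ... | inj₁ (f , s) | inj₁ (f′ , s′) = Pair-≡ (trans f (sym f′)) (trans s (sym s′))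
  ... | inj₂ (f , s) | inj₂ (f′ , s′) = Pair-≡ (trans f (sym f′)) (trans s (sym s′))
  ... | inj₁ (f , s) | inj₂ (f′ , s′) = ⊥-elim $ <ᴱ-asym (fst p) (snd p) (ordL p)
    (subst₂ (λ x y → T (_<ᴱ_ G x y)) (trans f′ (sym s)) (trans s′ (sym f)) (ordL q))
  ... | inj₂ (f , s) | inj₁ (f′ , s′) = ⊥-elim $ <ᴱ-asym (fst p) (snd p) (ordL p)
    (subst₂ (λ x y → T (_<ᴱ_ G x y)) (trans f′ (sym s)) (trans s′ (sym f)) (ordL q))

  Pair-≡-by-partner : ∀ {x} (p q : Pair) → x ∈ᵖ p → x ∈ᵖ q → partner p x ≡ partner q x → p ≡ q
  Pair-≡-by-partner {x} p q xp xq same =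
    Pair-≡-by-members p q (partner-≢ p xp ∘ sym) xp (partner-∈ p x) xq
      (subst (_∈ᵖ q) (sym same) (partner-∈ q x))

  pairBetween : ∀ {c} (f g : Edge) → f ≢ g → c ∈ᵉ f → c ∈ᵉ g → ∃[ p ] (f ∈ᵖ p × g ∈ᵖ p)
  pairBetween f g f≢g cf cg with <ᴱ-connex f g f≢g
  ... | inj₁ f<g =
    edgeL f g f<g (ℕₚ.≡⇒≡ᵇ _ _ (shared-end⇒Adj₁ f g f≢g cf cg)) , inj₁ refl , inj₂ refl
  ... | inj₂ g<f =
    edgeL g f g<f (ℕₚ.≡⇒≡ᵇ _ _ (shared-end⇒Adj₁ g f (f≢g ∘ sym) cg cf)) , inj₂ refl , inj₁ refl

  private
    shared-end : ∀ (p : Pair) → ∃[ c ] (c ∈ᵉ fst p × c ∈ᵉ snd p)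
    shared-end p = Adj₁⇒shared-end (fst p) (snd p) (ℕₚ.≡ᵇ⇒≡ _ _ (share p))

  centre : Pair → Fin n
  centre = proj₁ ∘ shared-end

  centre-∈ : ∀ {x} (p : Pair) → x ∈ᵖ p → centre p ∈ᵉ x
  centre-∈ p (inj₁ refl) = proj₁ (proj₂ (shared-end p))
  centre-∈ p (inj₂ refl) = proj₂ (proj₂ (shared-end p))

  centre-unique : ∀ {x y c} (p : Pair) → x ≢ y → x ∈ᵖ p → y ∈ᵖ p → c ∈ᵉ x → c ∈ᵉ y → c ≡ centre p
  centre-unique {x} {y} {c} p x≢y xp yp cx cy with c Finₚ.≟ centre p
  ... | yes c≡ = c≡
  ... | no c≢  = contradiction (Edge-≡-by-ends x y c≢ cx (centre-∈ p xp) cy (centre-∈ p yp)) x≢y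

  encodeEdge : Edge → Fin (n * n)
  encodeEdge e = Fin.combine (lo e) (hi e)

  encodePair : Pair → Fin ((n * n) * (n * n))
  encodePair p = Fin.combine (encodeEdge (fst p)) (encodeEdge (snd p))

  encodeEdge-injective : ∀ {e f} → encodeEdge e ≡ encodeEdge f → e ≡ f
  encodeEdge-injective {e} {f} same with Finₚ.combine-injective (lo e) (hi e) (lo f) (hi f) same
  ... | lo≡ , hi≡ = Edge-≡ lo≡ hi≡

  encodePair-injective : ∀ {p q} → encodePair p ≡ encodePair q → p ≡ q
  encodePair-injective {p} {q} same
    with Finₚ.combine-injective (encodeEdge (fst p)) (encodeEdge (snd p)) (encodeEdge (fst q)) (encodeEdge (snd q)) same
  ... | fst≡ , snd≡ = Pair-≡ (encodeEdge-injective fst≡) (encodeEdge-injective snd≡)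

module ReducedCliques (G : SimpleGraph) where
  open SimpleGraph G using (n; adj)
  open Edges G
  open Pairs G

  Adj₂-sym : ∀ {p q : Pair} → Adj₂ G p q → Adj₂ G q p
  Adj₂-sym (x , xp , xq , unique) = x , xq , xp , λ y yq yp → unique y yp yq

  Adj₂-irrefl : ∀ (p : Pair) → ¬ Adj₂ G p p
  Adj₂-irrefl p (_ , _ , _ , unique) =
    fst≢snd p (trans (unique (fst p) (inj₁ refl) (inj₁ refl)) (sym (unique (snd p) (inj₂ refl) (inj₂ refl))))

  Adj₂-shared-unique : ∀ {p q : Pair} {x y} → Adj₂ G p q → x ∈ᵖ p → x ∈ᵖ q → y ∈ᵖ p → y ∈ᵖ q → x ≡ y
  Adj₂-shared-unique (_ , _ , _ , unique) xp xq yp yq = trans (unique _ xp xq) (sym (unique _ yp yq))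

  Deleted-sym : ∀ {p q : Pair} → Deleted G p q → Deleted G q p
  Deleted-sym (a , b , c , triangle , p∈ , q∈) = a , b , c , triangle , q∈ , p∈

  Adj𝔏-sym : ∀ {p q : Pair} → Adj𝔏 G p q → Adj𝔏 G q p
  Adj𝔏-sym {p} {q} (adj₂ , not-deleted) = Adj₂-sym {p} {q} adj₂ , not-deleted ∘ Deleted-sym {q} {p}

  XEdge-sym : ∀ {t} (p q : Pair) → XEdge G t p q → XEdge G t q p
  XEdge-sym p q (tp , tq , pq) = tq , tp , Adj𝔏-sym {p} {q} pq

  same-centre⇒Deleted : ∀ {t} p q → t ∈ᵖ p → t ∈ᵖ q → p ≢ q → centre p ≡ centre q → Deleted G p q
  same-centre⇒Deleted {t} p q tp tq p≢q same =
    t , partner p t , partner q t ,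
    (shared-end⇒Adj₁ t (partner p t) (partner-≢ p tp ∘ sym) c∈t c∈partner-p ,
     shared-end⇒Adj₁ (partner p t) (partner q t) (p≢q ∘ Pair-≡-by-partner p q tp tq) c∈partner-p c∈partner-q ,
     shared-end⇒Adj₁ t (partner q t) (partner-≢ q tq ∘ sym) c∈t c∈partner-q) ,
    (λ y yp → [ inj₁ , inj₂ ∘ inj₁ ]′ (∈ᵖ-cases p tp yp)) ,
    (λ y yq → [ inj₁ , inj₂ ∘ inj₂ ]′ (∈ᵖ-cases q tq yq))
    where
      c∈t = centre-∈ p tp
      c∈partner-p = centre-∈ p (partner-∈ p t)
      c∈partner-q = subst (_∈ᵉ partner q t) (sym same) (centre-∈ q (partner-∈ q t))

  Adj𝔏⇒centres-≢ : ∀ {t} (p q : Pair) → t ∈ᵖ p → t ∈ᵖ q → Adj𝔏 G p q → centre p ≢ centre q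
  Adj𝔏⇒centres-≢ p q tp tq (adj₂ , not-deleted) =
    not-deleted ∘ same-centre⇒Deleted p q tp tq (λ { refl → Adj₂-irrefl p adj₂ })

  XEdge-centre-opp : ∀ {t} (p q : Pair) → XEdge G t p q → centre q ≡ opp t (centre p)
  XEdge-centre-opp {t} p q (tp , tq , pq) with ∈ᵉ-cases t (centre-∈ p tp) (centre-∈ q tq)
  ... | inj₁ same     = contradiction (sym same) (Adj𝔏⇒centres-≢ p q tp tq pq)
  ... | inj₂ opposite = opposite

  pairs-with-centre-collide : Cubic G → ∀ {t w} (q₁ q₂ q₃ : Pair) →
    t ∈ᵖ q₁ → t ∈ᵖ q₂ → t ∈ᵖ q₃ → centre q₁ ≡ w → centre q₂ ≡ w → centre q₃ ≡ w →
    q₁ ≡ q₂ ⊎ q₁ ≡ q₃ ⊎ q₂ ≡ q₃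
  pairs-with-centre-collide cubic {t} {w} q₁ q₂ q₃ t₁ t₂ t₃ c₁ c₂ c₃
    with q₁ ≟ᵖ q₂ | q₁ ≟ᵖ q₃ | q₂ ≟ᵖ q₃
  ... | yes q₁≡q₂ | _         | _         = inj₁ q₁≡q₂
  ... | no _      | yes q₁≡q₃ | _         = inj₂ (inj₁ q₁≡q₃)
  ... | no _      | no _      | yes q₂≡q₃ = inj₂ (inj₂ q₂≡q₃)
  ... | no q₁≢q₂  | no q₁≢q₃  | no q₂≢q₃  =
    ⊥-elim $ ℕₚ.<-irrefl refl (subst (4 ≤_) (cubic w) (Counting.unique-≤-count (adj w) distinct adjacent))
    where
      w∈t : w ∈ᵉ t
      w∈t = subst (_∈ᵉ t) c₁ (centre-∈ q₁ t₁)

      w∈partner : ∀ q → t ∈ᵖ q → centre q ≡ w → w ∈ᵉ partner q t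
      w∈partner q tq refl = centre-∈ q (partner-∈ q t)

      far : ∀ q → t ∈ᵖ q → centre q ≡ w → opp t w ≢ opp (partner q t) w
      far q tq cq = partner-≢ q tq ∘ sym ∘ opp-injective t (partner q t) w∈t (w∈partner q tq cq)

      apart : ∀ q r → t ∈ᵖ q → t ∈ᵖ r → centre q ≡ w → centre r ≡ w → q ≢ r →
              opp (partner q t) w ≢ opp (partner r t) w
      apart q r tq tr cq cr q≢r =
        q≢r ∘ Pair-≡-by-partner q r tq tr ∘ opp-injective _ _ (w∈partner q tq cq) (w∈partner r tr cr)

      neighbours : List (Fin n)
      neighbours = opp t w ∷ opp (partner q₁ t) w ∷ opp (partner q₂ t) w ∷ opp (partner q₃ t) w ∷ []

      distinct : Unique neighbours
      distinct = (far q₁ t₁ c₁ ∷ far q₂ t₂ c₂ ∷ far q₃ t₃ c₃ ∷ [])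
               ∷ (apart q₁ q₂ t₁ t₂ c₁ c₂ q₁≢q₂ ∷ apart q₁ q₃ t₁ t₃ c₁ c₃ q₁≢q₃ ∷ [])
               ∷ (apart q₂ q₃ t₂ t₃ c₂ c₃ q₂≢q₃ ∷ [])
               ∷ [] ∷ []

      adjacent : All (T ∘ adj w) neighbours
      adjacent = opp-adjacent t w∈t
               ∷ opp-adjacent (partner q₁ t) (w∈partner q₁ t₁ c₁)
               ∷ opp-adjacent (partner q₂ t) (w∈partner q₂ t₂ c₂)
               ∷ opp-adjacent (partner q₃ t) (w∈partner q₃ t₃ c₃) ∷ []

module ValidLabelings (G : SimpleGraph) (cubic : Cubic G) (L : Labeling G) (valid : Valid G L) where
  open Edges G
  open Pairs G
  open ReducedCliques G

  lab : Pair → Pair → Bool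
  lab = proj₁ L

  Open-sym : ∀ {p q : Pair} → Open G L p q → Open G L q p
  Open-sym {p} {q} (pq , open-pq) = Adj𝔏-sym {p} {q} pq , trans (proj₂ L q p) open-pq

  record CliqueNeighbours (t : Edge) (p : Pair) : Set where
    field
      on off     : Pair
      on-edge    : XEdge G t p on
      off-edge   : XEdge G t p off
      on-open    : lab p on ≡ true
      off-closed : lab p off ≡ false
      covers     : ∀ q → XEdge G t p q → q ≡ on ⊎ q ≡ off

    on-unique : ∀ q → XEdge G t p q → lab p q ≡ true → q ≡ on
    on-unique q tpq open-pq with covers q tpq
    ... | inj₁ q≡on  = q≡on
    ... | inj₂ refl = contradiction (trans (sym open-pq) off-closed) λ ()

    off-unique : ∀ q → XEdge G t p q → lab p q ≡ false → q ≡ off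
    off-unique q tpq closed-pq with covers q tpq
    ... | inj₁ refl = contradiction (trans (sym on-open) closed-pq) λ ()
    ... | inj₂ q≡off = q≡off

    Open-on : Open G L p on
    Open-on = proj₂ (proj₂ on-edge) , on-open

  opaque
    clique-neighbours : ∀ t p → t ∈ᵖ p → CliqueNeighbours t p
    clique-neighbours t p tp with valid t p tp
    ... | w , u , _ , _ , tpw , tpu , labels-differ = by-label (lab p u) refl
      where
        covers : ∀ q → XEdge G t p q → q ≡ w ⊎ q ≡ u
        covers q tpq
          with pairs-with-centre-collide cubic w u q (proj₁ (proj₂ tpw)) (proj₁ (proj₂ tpu)) (proj₁ (proj₂ tpq))
                 (XEdge-centre-opp p w tpw) (XEdge-centre-opp p u tpu) (XEdge-centre-opp p q tpq)
        ... | inj₁ w≡u        = contradiction labels-differ (not-¬ (cong (lab p) w≡u))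
        ... | inj₂ (inj₁ w≡q) = inj₁ (sym w≡q)
        ... | inj₂ (inj₂ u≡q) = inj₂ (sym u≡q)

        by-label : ∀ b → lab p u ≡ b → CliqueNeighbours t p
        by-label true  lu = record { on = u ; off = w ; on-edge = tpu ; off-edge = tpw
                                   ; on-open = lu ; off-closed = trans labels-differ (cong not lu)
                                   ; covers = λ q → Data.Sum.swap ∘ covers q }
        by-label false lu = record { on = w ; off = u ; on-edge = tpw ; off-edge = tpu
                                   ; on-open = trans labels-differ (cong not lu) ; off-closed = lu
                                   ; covers = covers }

  onThrough : ∀ x q → x ∈ᵖ q → Pair
  onThrough x q xq = CliqueNeighbours.on (clique-neighbours x q xq)

  openNbr₁ openNbr₂ : Pair → Pair
  openNbr₁ q = onThrough (fst q) q (inj₁ refl)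
  openNbr₂ q = onThrough (snd q) q (inj₂ refl)

  Open-onThrough : ∀ x q (xq : x ∈ᵖ q) → Open G L q (onThrough x q xq)
  Open-onThrough x q xq = CliqueNeighbours.Open-on (clique-neighbours x q xq)

  Open⇒openNbr : ∀ {q p} → Open G L q p → p ≡ openNbr₁ q ⊎ p ≡ openNbr₂ q
  Open⇒openNbr {q} {p} (qp@((_ , inj₁ refl , xp , _) , _) , open-qp) =
    inj₁ (CliqueNeighbours.on-unique (clique-neighbours (fst q) q (inj₁ refl)) p (inj₁ refl , xp , qp) open-qp)
  Open⇒openNbr {q} {p} (qp@((_ , inj₂ refl , xp , _) , _) , open-qp) =
    inj₂ (CliqueNeighbours.on-unique (clique-neighbours (snd q) q (inj₂ refl)) p (inj₂ refl , xp , qp) open-qp)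

  openNbr₁≢openNbr₂ : ∀ q → openNbr₁ q ≢ openNbr₂ q
  openNbr₁≢openNbr₂ q same =
    fst≢snd q (Adj₂-shared-unique {q} {openNbr₁ q} (proj₁ (proj₂ (proj₂ via-fst)))
                 (inj₁ refl) fst∈nbr (inj₂ refl) snd∈nbr)
    where
      via-fst = CliqueNeighbours.on-edge (clique-neighbours (fst q) q (inj₁ refl))
      via-snd = CliqueNeighbours.on-edge (clique-neighbours (snd q) q (inj₂ refl))
      fst∈nbr = proj₁ (proj₂ via-fst)
      snd∈nbr = subst (snd q ∈ᵖ_) (sym same) (proj₁ (proj₂ via-snd))

  Open-irrefl : ∀ p → ¬ Open G L p p
  Open-irrefl p = Adj₂-irrefl p ∘ proj₁ ∘ proj₁

  open TwoRegular _≟ᵖ_ (Open G L) Open-sym Open-irrefl openNbr₁ openNbr₂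
    (λ q → Open-onThrough (fst q) q (inj₁ refl)) (λ q → Open-onThrough (snd q) q (inj₂ refl))
    openNbr₁≢openNbr₂ Open⇒openNbr public

module BridgeArgument (G : SimpleGraph) (cubic : Cubic G) (L : Labeling G) (valid : Valid G L)
                      {a b : Fin (SimpleGraph.n G)} (bridge : IsBridge G a b) where
  open SimpleGraph G using (n; adj)
  open Edges G
  open Pairs G
  open ReducedCliques G
  open ValidLabelings G cubic L valid

  e : Edge
  e = proj₁ (edgeBetween (proj₁ bridge))

  a∈e : a ∈ᵉ e
  a∈e = proj₁ (proj₂ (edgeBetween (proj₁ bridge)))

  b∈e : b ∈ᵉ e
  b∈e = proj₂ (proj₂ (edgeBetween (proj₁ bridge)))

  a≢b : a ≢ b
  a≢b = adj⇒≢ (proj₁ bridge)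

  opp-e-b : opp e b ≡ a
  opp-e-b with ∈ᵉ-cases e b∈e a∈e
  ... | inj₁ a≡b   = contradiction a≡b a≢b
  ... | inj₂ a≡opp = sym a≡opp

  ∈e-cases : ∀ {c} → c ∈ᵉ e → c ≡ a ⊎ c ≡ b
  ∈e-cases c∈e with ∈ᵉ-cases e a∈e c∈e | ∈ᵉ-cases e a∈e b∈e
  ... | inj₁ c≡a   | _          = inj₁ c≡a
  ... | inj₂ _     | inj₁ b≡a   = contradiction (sym b≡a) a≢b
  ... | inj₂ c≡opp | inj₂ b≡opp = inj₂ (trans c≡opp (sym b≡opp))

  AvoidsBridge : Fin n → Fin n → Set
  AvoidsBridge u v = Adj G u v × ¬ ((u ≡ a × v ≡ b) ⊎ (u ≡ b × v ≡ a))

  OnASide : Pair → Set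
  OnASide p = Star AvoidsBridge a (centre p)

  spans-bridge : ∀ {z} → a ∈ᵉ z → b ∈ᵉ z → z ≡ e
  spans-bridge {z} az bz = Edge-≡-by-ends z e a≢b az bz a∈e b∈e

  OnASide-step : ∀ {u v} → Open G L u v → ¬ (e ∈ᵖ u × e ∈ᵖ v) → OnASide u → OnASide v
  OnASide-step {u} {v} (uv@((z , zu , zv , _) , _) , _) ¬crossing side =
    side ◅◅ (ends-adjacent z (Adj𝔏⇒centres-≢ u v zu zv uv) cu∈z cv∈z , z≢e ∘ z-spans-bridge) ◅ ε
    where
      cu∈z = centre-∈ u zu
      cv∈z = centre-∈ v zv
      z≢e : z ≢ e
      z≢e z≡e = ¬crossing (subst (_∈ᵖ u) z≡e zu , subst (_∈ᵖ v) z≡e zv)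
      z-spans-bridge : (centre u ≡ a × centre v ≡ b) ⊎ (centre u ≡ b × centre v ≡ a) → z ≡ e
      z-spans-bridge (inj₁ (ua , vb)) = spans-bridge (subst (_∈ᵉ z) ua cu∈z) (subst (_∈ᵉ z) vb cv∈z)
      z-spans-bridge (inj₂ (ub , va)) = spans-bridge (subst (_∈ᵉ z) va cv∈z) (subst (_∈ᵉ z) ub cu∈z)

  OnASide⇒centre≡a : ∀ {p} → e ∈ᵖ p → OnASide p → centre p ≡ a
  OnASide⇒centre≡a {p} ep side with ∈e-cases (centre-∈ p ep)
  ... | inj₁ c≡a = c≡a
  ... | inj₂ c≡b = contradiction (subst (Star AvoidsBridge a) c≡b side) (proj₂ bridge)

  another-neighbour : ∃[ v ] (Adj G a v × v ≢ b)
  another-neighbour with Finₚ.any? (λ v → T? (adj a v) ×-dec ¬? (v Finₚ.≟ b))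
  ... | yes found = found
  ... | no none   = contradiction (subst (_≤ 1) (cubic a) (Counting.count≤1 (adj a) b only-b)) λ { (s≤s ()) }
    where
      only-b : ∀ v → T (adj a v) → v ≡ b
      only-b v av with v Finₚ.≟ b
      ... | yes v≡b = v≡b
      ... | no v≢b  = contradiction (v , av , v≢b) none

  opaque
    pair-at-a : ∃[ p ] (e ∈ᵖ p × centre p ≡ a)
    pair-at-a =
      let v , av , v≢b   = another-neighbour
          f , a∈f , v∈f  = edgeBetween av
          e≢f : e ≢ f
          e≢f e≡f = [ adj⇒≢ av ∘ sym , v≢b ]′ (∈e-cases (subst (v ∈ᵉ_) (sym e≡f) v∈f))
          p , ep , fp    = pairBetween e f e≢f a∈e a∈f
      in  p , ep , sym (centre-unique p e≢f ep fp a∈e a∈f)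

  p₀ : Pair
  p₀ = proj₁ pair-at-a

  e∈p₀ : e ∈ᵖ p₀
  e∈p₀ = proj₁ (proj₂ pair-at-a)

  centre-p₀ : centre p₀ ≡ a
  centre-p₀ = proj₂ (proj₂ pair-at-a)

  module 𝕏₀ = CliqueNeighbours (clique-neighbours e p₀ e∈p₀)

  open Walk encodePair encodePair-injective 𝕏₀.on p₀ (Open-sym 𝕏₀.Open-on)

  C : Pair → Set
  C = Star (Open G L) p₀

  S : Pair → Pair → Set
  S = AfterFlip G L e C

  open-edge-in-S : ∀ {p q} → C p → Open G L p q → ¬ XEdge G e p q → S p q
  open-edge-in-S cp pq ¬xedge = inj₁ ((pq , cp , cp ◅◅ pq ◅ ε) , ¬xedge)

  walk-in-C : ∀ k → C (walk (suc k))
  walk-in-C zero    = ε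
  walk-in-C (suc k) = walk-in-C k ◅◅ walk-R (suc k) ◅ ε

  Crossing : ℕ → Set
  Crossing k = e ∈ᵖ walk k × e ∈ᵖ walk (suc k)

  Explored : Pair → Set
  Explored p = OnASide p × Star S p₀ p

  explore-step : ∀ k → ¬ Crossing (suc k) → Explored (walk (suc k)) → Explored (walk (2 + k))
  explore-step k ¬crossing (side , reach) =
    OnASide-step (walk-R (suc k)) ¬crossing side ,
    reach ◅◅ open-edge-in-S (walk-in-C k) (walk-R (suc k)) (¬crossing ∘ Data.Product.map₂ proj₁) ◅ ε

  first-crossing : ∀ d k → Crossing (d + suc k) → Explored (walk (suc k)) →
                   ∃[ j ] (Crossing (suc j) × Explored (walk (suc j)))
  first-crossing zero    k crossing explored = k , crossing , explored
  first-crossing (suc d) k crossing explored with (e ∈ᵖ? walk (suc k)) ×-dec (e ∈ᵖ? walk (2 + k))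
  ... | yes crossing-now = k , crossing-now , explored
  ... | no ¬crossing-now = first-crossing d (suc k)
          (subst Crossing (sym (ℕₚ.+-suc d (suc k))) crossing) (explore-step k ¬crossing-now explored)

  opaque
    returns-to-clique : ∃[ j ] (Crossing (suc j) × Explored (walk (suc j)))
    returns-to-clique =
      let d , returns = walk-returns
      in  first-crossing d 0
            (subst Crossing (ℕₚ.+-comm 1 d)
               (subst (e ∈ᵖ_) (sym (cong proj₁ returns)) (proj₁ (proj₂ 𝕏₀.on-edge)) ,
                subst (e ∈ᵖ_) (sym (cong proj₂ returns)) e∈p₀))
            (subst (Star AvoidsBridge a) (sym centre-p₀) ε , ε)

  return-time : ℕ
  return-time = proj₁ returns-to-clique

  p′ : Pair
  p′ = walk (suc return-time)

  e∈p′ : e ∈ᵖ p′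
  e∈p′ = proj₁ (proj₁ (proj₂ returns-to-clique))

  centre-p′ : centre p′ ≡ a
  centre-p′ = OnASide⇒centre≡a {p′} e∈p′ (proj₁ (proj₂ (proj₂ returns-to-clique)))

  p′-reachable : Star S p₀ p′
  p′-reachable = proj₂ (proj₂ (proj₂ returns-to-clique))

  p₀≢p′ : p₀ ≢ p′
  p₀≢p′ p₀≡p′ = no-reversal (suc return-time) 0 (begin
    state (suc return-time + 0)  ≡⟨ cong state (ℕₚ.+-identityʳ (suc return-time)) ⟩
    state (suc return-time)      ≡⟨ cong₂ _,_ (sym p₀≡p′) back-to-on ⟩
    (p₀ , 𝕏₀.on)       ∎)
    where
      open ≡-Reasoning
      open-from-p₀ : Open G L p₀ (walk (2 + return-time))
      open-from-p₀ = subst (λ r → Open G L r (walk (2 + return-time))) (sym p₀≡p′) (walk-R (suc return-time))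
      back-to-on : walk (2 + return-time) ≡ 𝕏₀.on
      back-to-on = 𝕏₀.on-unique (walk (2 + return-time))
        (e∈p₀ , proj₂ (proj₁ (proj₂ returns-to-clique)) , proj₁ open-from-p₀) (proj₂ open-from-p₀)

  at-a⇒p₀-or-p′ : ∀ r → e ∈ᵖ r → centre r ≡ a → r ≡ p₀ ⊎ r ≡ p′
  at-a⇒p₀-or-p′ r er centre-r
    with pairs-with-centre-collide cubic p₀ p′ r e∈p₀ e∈p′ er centre-p₀ centre-p′ centre-r
  ... | inj₁ p₀≡p′        = contradiction p₀≡p′ p₀≢p′
  ... | inj₂ (inj₁ p₀≡r) = inj₁ (sym p₀≡r)
  ... | inj₂ (inj₂ p′≡r) = inj₂ (sym p′≡r)

  at-a⇒explored : ∀ r → e ∈ᵖ r → centre r ≡ a → C r × Star S p₀ r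
  at-a⇒explored r er centre-r with at-a⇒p₀-or-p′ r er centre-r
  ... | inj₁ refl = ε , ε
  ... | inj₂ refl = walk-in-C return-time , p′-reachable

  clique-explored : ∀ r → e ∈ᵖ r → C r × Star S p₀ r
  clique-explored r er with ∈e-cases (centre-∈ r er)
  ... | inj₁ centre≡a = at-a⇒explored r er centre≡a
  ... | inj₂ centre≡b =
    proj₁ (at-a⇒explored 𝕏.on (proj₁ (proj₂ 𝕏.on-edge)) (across 𝕏.on 𝕏.on-edge))
      ◅◅ Open-sym {r} {𝕏.on} 𝕏.Open-on ◅ ε ,
    proj₂ (at-a⇒explored 𝕏.off (proj₁ (proj₂ 𝕏.off-edge)) (across 𝕏.off 𝕏.off-edge))
      ◅◅ inj₂ (XEdge-sym r 𝕏.off 𝕏.off-edge , trans (proj₂ L 𝕏.off r) 𝕏.off-closed) ◅ ε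
    where
      module 𝕏 = CliqueNeighbours (clique-neighbours e r er)
      across : ∀ q → XEdge G e r q → centre q ≡ a
      across q erq = begin
        centre q           ≡⟨ XEdge-centre-opp r q erq ⟩
        opp e (centre r)   ≡⟨ cong (opp e) centre≡b ⟩
        opp e b            ≡⟨ opp-e-b ⟩
        a                  ∎
        where open ≡-Reasoning

  S-sym : ∀ {p q} → S p q → S q p
  S-sym {p} {q} (inj₁ ((pq , cp , cq) , ¬xedge)) = inj₁ ((Open-sym {p} {q} pq , cq , cp) , ¬xedge ∘ XEdge-sym q p)
  S-sym {p} {q} (inj₂ (xedge , closed))          = inj₂ (XEdge-sym p q xedge , trans (proj₂ L q p) closed)

  open-step-reachable : ∀ {u v} → C u → Star S p₀ u → Open G L u v → Star S p₀ v
  open-step-reachable {u} {v} cu reach uv with e ∈ᵖ? u | e ∈ᵖ? v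
  ... | yes _   | yes ev = proj₂ (clique-explored v ev)
  ... | no ¬eu  | _      = reach ◅◅ open-edge-in-S cu uv (¬eu ∘ proj₁) ◅ ε
  ... | yes _   | no ¬ev = reach ◅◅ open-edge-in-S cu uv (¬ev ∘ proj₁ ∘ proj₂) ◅ ε

  C⇒reachable : ∀ {r} → C r → Star S p₀ r
  C⇒reachable = extend ε ε
    where
      extend : ∀ {u r} → C u → Star S p₀ u → Star (Open G L) u r → Star S p₀ r
      extend cu reach ε          = reach
      extend cu reach (uv ◅ vr)  = extend (cu ◅◅ uv ◅ ε) (open-step-reachable cu reach uv) vr

  S⇒C : ∀ {p q} → S p q → C p
  S⇒C (inj₁ ((_ , cp , _) , _)) = cp
  S⇒C (inj₂ (xedge , _))        = proj₁ (clique-explored _ (proj₁ xedge))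

  TwoNeighbours : (Pair → Set) → Set
  TwoNeighbours N = ∃[ x ] ∃[ y ] (x ≢ y × N x × N y × (∀ c → N c → c ≡ x ⊎ c ≡ y))

  S-degree-two-outside : ∀ p → C p → ¬ e ∈ᵖ p → TwoNeighbours (S p)
  S-degree-two-outside p cp ¬ep =
    openNbr₁ p , openNbr₂ p , openNbr₁≢openNbr₂ p ,
    open-S (Open-onThrough (fst p) p (inj₁ refl)) , open-S (Open-onThrough (snd p) p (inj₂ refl)) , covers
    where
      open-S : ∀ {q} → Open G L p q → S p q
      open-S pq = open-edge-in-S cp pq (¬ep ∘ proj₁)
      covers : ∀ c → S p c → c ≡ openNbr₁ p ⊎ c ≡ openNbr₂ p
      covers c (inj₁ ((pc , _) , _)) = Open⇒openNbr pc
      covers c (inj₂ (xedge , _))    = contradiction (proj₁ xedge) ¬ep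

  S-degree-two-inside : ∀ p → (ep : e ∈ᵖ p) → TwoNeighbours (S p)
  S-degree-two-inside p ep =
    onward , 𝕏.off , onward≢off ,
    open-edge-in-S cp (Open-onThrough (partner p e) p partner∈p) onward-not-in-𝕏 ,
    inj₂ (𝕏.off-edge , 𝕏.off-closed) , covers
    where
      module 𝕏 = CliqueNeighbours (clique-neighbours e p ep)
      partner∈p = partner-∈ p e
      module 𝕐 = CliqueNeighbours (clique-neighbours (partner p e) p partner∈p)
      onward = 𝕐.on
      cp = proj₁ (clique-explored p ep)
      onward-not-in-𝕏 : ¬ XEdge G e p onward
      onward-not-in-𝕏 (_ , e∈onward , _) =
        partner-≢ p ep (Adj₂-shared-unique {p} {onward} (proj₁ (proj₂ (proj₂ 𝕐.on-edge)))
          partner∈p (proj₁ (proj₂ 𝕐.on-edge)) ep e∈onward)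
      onward≢off : onward ≢ 𝕏.off
      onward≢off onward≡off = onward-not-in-𝕏 (subst (XEdge G e p) (sym onward≡off) 𝕏.off-edge)
      covers : ∀ c → S p c → c ≡ onward ⊎ c ≡ 𝕏.off
      covers c (inj₂ (xedge , closed)) = inj₂ (𝕏.off-unique c xedge closed)
      covers c (inj₁ (((pc@((z , zp , zc , _) , _) , open-pc) , _) , ¬xedge)) with ∈ᵖ-cases p ep zp
      ... | inj₁ refl = contradiction (zp , zc , pc) ¬xedge
      ... | inj₂ refl = inj₁ (𝕐.on-unique c (partner∈p , zc , pc) open-pc)

  S-degree-two : ∀ p q → S p q → TwoNeighbours (S p)
  S-degree-two p q pq with e ∈ᵖ? p
  ... | yes ep = S-degree-two-inside p ep
  ... | no ¬ep = S-degree-two-outside p (S⇒C pq) ¬ep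

  Γ-component : InΓ G L C
  Γ-component = (p₀ , ε) , (λ _ _ cp pq → cp ◅◅ pq ◅ ε) , λ _ _ cp cq → reverse Open-sym cp ◅◅ cq

  self-intersection : SelfIntersection G L e C
  self-intersection p q xedge open-pq =
    (proj₂ (proj₂ xedge) , open-pq) ,
    proj₁ (clique-explored p (proj₁ xedge)) , proj₁ (clique-explored q (proj₁ (proj₂ xedge)))

  flip-is-single-cycle : SingleCycle G L S
  flip-is-single-cycle =
    (p₀ , 𝕏₀.off , inj₂ (𝕏₀.off-edge , 𝕏₀.off-closed)) , S-degree-two ,
    λ _ _ _ _ pp′ qq′ → reverse S-sym (C⇒reachable (S⇒C pp′)) ◅◅ C⇒reachable (S⇒C qq′)

lemma2p18 : (G : SimpleGraph) → Connected G → Cubic G → TriangleFree G →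
              HasBridge G → (L : Labeling G) → Valid G L →
              ∃[ x ] ∃[ C ] (InΓ G L C × TypeA G L x C)
lemma2p18 G _ cubic _ (_ , _ , bridge) L valid =
  e , C , Γ-component , self-intersection , flip-is-single-cycle
  where open BridgeArgument G cubic L valid bridge
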